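{- Let $m\ge0$ and $k$ be integers with $m+k\le n$, and let $S=\{m+1,\ldots,m+k\}\subseteq\mathbf n$. Then $\dim_F\langle v_S\rangle=\binom{m+k}{k}$.
   Context: $\mathbf n=\{1,\ldots,n\}$. $\mathcal{IC}_n$ is the monoid (under composition) of all injective partial maps $f$ from $D(f)\subseteq\mathbf n$ onto a subset of $\mathbf n$ that are order preserving and order decreasing ($f(a)\le a$); the empty map is included. $F$ is a field of characteristic $0$; $V$ has $F$-basis $\{v_S:S\subseteq\mathbf n\}$ with action $f\cdot v_S=v_{f(S)}$ if $S\subseteq D(f)$ and $0$ otherwise; $\langle v_S\rangle$ is the $\mathcal{IC}_n$-submodule generated by $v_S$. -}

module Defs where

open import Level using (Level; _⊔_) renaming (suc to lsuc)
open import Algebra.Bundles using (CommutativeRing)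
open import Data.Nat as ℕ using (ℕ; zero; suc)
open import Data.Fin as Fin using (Fin; zero; suc; toℕ)
open import Data.Fin.Subset using (Subset)
open import Data.Bool using (Bool; true; false; _∧_; _∨_; if_then_else_)
open import Data.Vec using (Vec; lookup; tabulate)
open import Data.Vec.Properties using (≡-dec)
import Data.Bool.Properties as BoolP
open import Data.Maybe using (Maybe; just; nothing)
open import Data.Product using (Σ; _×_; ∃)
open import Relation.Binary.PropositionalEquality using (_≡_)
open import Relation.Nullary using (¬_)
open import Relation.Nullary.Decidable using (⌊_⌋)

record Field (c ℓ : Level) : Set (lsuc (c ⊔ ℓ)) where
  field
    commutativeRing : CommutativeRing c ℓ
  open CommutativeRing commutativeRing public hiding (zero)
  field
    1≉0 : ¬ (1# ≈ 0#)
    inverse : ∀ x → ¬ (x ≈ 0#) → ∃ λ y → (x * y) ≈ 1#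

  fromℕ : ℕ → Carrier
  fromℕ zero = 0#
  fromℕ (suc k) = 1# + fromℕ k

CharZero : ∀ {c ℓ} → Field c ℓ → Set ℓ
CharZero F = ∀ k → ¬ (fromℕ (suc k) ≈ 0#)
  where open Field F

-- The set 𝐧 = {1,…,n} is represented by Fin n,
-- with i : Fin n standing for i+1.  A partial map 𝐧 ⇀ 𝐧 is a function
-- Fin n → Maybe (Fin n); its domain D(f) = { x | fun x ≡ just _ }.

record IC (n : ℕ) : Set where
  field
    fun : Fin n → Maybe (Fin n)
    injective : ∀ x y a → fun x ≡ just a → fun y ≡ just a → x ≡ y
    order-preserving : ∀ x y a b → fun x ≡ just a → fun y ≡ just b →
                       x Fin.≤ y → a Fin.≤ b
    order-decreasing : ∀ x a → fun x ≡ just a → a Fin.≤ x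

anyFin : ∀ {n} → (Fin n → Bool) → Bool
anyFin {zero} p = false
anyFin {suc n} p = p zero ∨ anyFin (λ i → p (suc i))

allFin : ∀ {n} → (Fin n → Bool) → Bool
allFin {zero} p = true
allFin {suc n} p = p zero ∧ allFin (λ i → p (suc i))

isJust : ∀ {n} → Maybe (Fin n) → Bool
isJust (just _) = true
isJust nothing = false

hits : ∀ {n} → Maybe (Fin n) → Fin n → Bool
hits (just a) y = ⌊ a Fin.≟ y ⌋
hits nothing y = false

⊆dom : ∀ {n} → IC n → Subset n → Bool
⊆dom f S = allFin (λ x → if lookup S x then isJust (IC.fun f x) else true)

image : ∀ {n} → IC n → Subset n → Subset n
image f S = tabulate (λ y → anyFin (λ x → lookup S x ∧ hits (IC.fun f x) y))

-- The module V over a field F: vectors are F-valued functions on the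
-- basis {v_S : S ⊆ 𝐧} (i.e. coordinate functions), with pointwise
-- structure and pointwise equality.

module Module {c ℓ} (F : Field c ℓ) where
  open Field F

  V : ℕ → Set c
  V n = Subset n → Carrier

  _≈V_ : ∀ {n} → V n → V n → Set ℓ
  u ≈V w = ∀ U → u U ≈ w U

  0V : ∀ {n} → V n
  0V U = 0#

  v : ∀ {n} → Subset n → V n
  v S U = if ⌊ ≡-dec BoolP._≟_ S U ⌋ then 1# else 0#

  act : ∀ {n} → IC n → Subset n → V n
  act f S = if ⊆dom f S then v (image f S) else 0V

  Σ[_] : ∀ {k} → (Fin k → Carrier) → Carrier
  Σ[_] {zero} a = 0#
  Σ[_] {suc k} a = a zero + Σ[ (λ i → a (suc i)) ]

  lincomb : ∀ {n k} → (Fin k → Carrier) → (Fin k → V n) → V n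
  lincomb cs bs U = Σ[ (λ i → cs i * bs i U) ]

  -- ⟨v_S⟩: the IC_n-submodule generated by v_S, i.e. the F-span of
  -- the orbit { f · v_S : f ∈ IC_n } (IC_n is a monoid with identity).
  ⟨v_⟩ : ∀ {n} → Subset n → V n → Set (c ⊔ ℓ)
  ⟨v_⟩ {n} S w = Σ ℕ λ k → Σ (Fin k → Carrier) λ cs → Σ (Fin k → IC n) λ fs →
                   w ≈V lincomb cs (λ i → act (fs i) S)

  LinIndep : ∀ {n d} → (Fin d → V n) → Set (c ⊔ ℓ)
  LinIndep bs = ∀ cs → lincomb cs bs ≈V 0V → ∀ i → cs i ≈ 0#

  HasDim : ∀ {n} → (V n → Set (c ⊔ ℓ)) → ℕ → Set (c ⊔ ℓ)
  HasDim {n} W d = Σ (Fin d → V n) λ bs →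
    (∀ i → W (bs i)) × LinIndep bs ×
    (∀ w → W w → Σ (Fin d → Carrier) λ cs → w ≈V lincomb cs bs)

-- S = {m+1, …, m+k} ⊆ 𝐧 (as Fin n, element i stands for i+1)
interval : ∀ n → ℕ → ℕ → Subset n
interval n m k = tabulate (λ i → ⌊ m ℕ.≤? toℕ i ⌋ ∧ ⌊ toℕ i ℕ.<? m ℕ.+ k ⌋)

-- For S = {m+1, …, m+k} every f · v_S is either 0 or the basis vector v_{f(S)}, so ⟨v_S⟩ is
-- spanned by the distinct basis vectors v_T with T = f(S), and its dimension is the number of
-- such T.  As f is injective, order preserving and decreasing on S, these T are exactly the
-- k-sets {t_1 < ⋯ < t_k} with t_j ≤ m + j (each realised by the partial map m + j ↦ t_j).
-- Sorting them by whether the least point of 𝐧 lies in T gives Pascal's recursion for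
-- (m + k) C k.

module Submission where

open import Defs
open import Level using (Level)
open import Data.Nat
  using (ℕ; zero; suc; _+_; _∸_; _≤_; _<_; z≤n; s≤s; s≤s⁻¹; z<s; s<s; s<s⁻¹; _≤?_; _<?_)
open import Data.Nat.Properties
  using (+-suc; <⇒≤; <⇒≱; ≮⇒≥; n≮0; m≤n⇒m<n∨m≡n; m≤m+n; m+n≤o⇒n≤o; +-monoʳ-<; +-cancelˡ-<;
         m+[n∸m]≡n; ≤-trans)
open import Data.Nat.Combinatorics using (_C_; nCn≡1; nCk+nC[k+1]≡[n+1]C[k+1])
open import Data.Fin as Fin using (Fin; zero; suc; toℕ; fromℕ<; splitAt; join; _↑ˡ_; _↑ʳ_)
open import Data.Fin.Properties
  using (toℕ-injective; toℕ-fromℕ<; toℕ<n; ¬Fin0; 0≢1+n; punchIn-punchOut; punchInᵢ≢i;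
         splitAt-↑ˡ; splitAt-↑ʳ; join-splitAt; ≤∧≢⇒<; <⇒≢; any?)
  renaming (≤-reflexive to ≤ᶠ-reflexive; ≤-antisym to ≤ᶠ-antisym)
open import Data.Fin.Subset using (Subset; _∈_; ⊥)
open import Data.Fin.Subset.Properties using (⊆-antisym; ⊥⊆)
open import Data.Bool using (Bool; true; false; T; _∧_; _∨_; if_then_else_)
open import Data.Bool.Properties using (T-∧; T-∨; T-≡)
import Data.Bool.Properties as Bool
open import Data.Maybe using (Maybe; just; nothing)
open import Data.Maybe.Properties using (just-injective)
open import Data.Vec using ([]; _∷_; tabulate; lookup)
open import Data.Vec.Properties
  using (tabulate-cong; lookup∘tabulate; []=⇒lookup; lookup⇒[]=; ∷-injectiveˡ; ∷-injectiveʳ; ≡-dec)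
import Data.Vec.Functional as Vector
open import Data.Product using (Σ; ∃; _×_; _,_; proj₁; proj₂; map₂)
open import Data.Sum using (_⊎_; inj₁; inj₂)
open import Data.Empty using (⊥-elim)
open import Data.Unit using (tt)
open import Function using (_∘_; _⇔_; mk⇔; Equivalence)
open import Function.Definitions using (Injective)
open import Relation.Nullary using (Dec; yes; no; contradiction)
open import Relation.Nullary.Decidable using (⌊_⌋; toWitness; fromWitness; ⌊⌋-map′)
open import Relation.Binary.PropositionalEquality as ≡
  using (_≡_; _≢_; _≗_; refl; cong; cong₂; subst; subst₂; module ≡-Reasoning)

open Equivalence using (to; from)

binom : ℕ → ℕ → ℕ
binom m zero = 1
binom zero (suc k) = binom zero k
binom (suc m) (suc k) = binom (suc m) k + binom m (suc k)

binom≡C : ∀ m k → binom m k ≡ (m + k) C k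
binom≡C m zero = refl
binom≡C zero (suc k) = ≡.trans (binom≡C zero k) (≡.trans (nCn≡1 k) (≡.sym (nCn≡1 (suc k))))
binom≡C (suc m) (suc k) = begin
  binom (suc m) k + binom m (suc k)         ≡⟨ cong₂ _+_ (binom≡C (suc m) k) (binom≡C m (suc k)) ⟩
  (suc m + k) C k + (m + suc k) C (suc k)   ≡⟨ cong (λ x → (suc m + k) C k + x C suc k) (+-suc m k) ⟩
  suc (m + k) C k + suc (m + k) C (suc k)   ≡⟨ nCk+nC[k+1]≡[n+1]C[k+1] (suc (m + k)) k ⟩
  suc (suc (m + k)) C suc k                 ≡⟨ cong (λ x → suc x C suc k) (+-suc m k) ⟨
  (suc m + suc k) C suc k                   ∎
  where open ≡-Reasoning

anyFin⁻ : ∀ {k} (p : Fin k → Bool) → T (anyFin p) → ∃ λ x → T (p x)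
anyFin⁻ {suc k} p h with to T-∨ h
... | inj₁ p0 = zero , p0
... | inj₂ ps with anyFin⁻ (p ∘ suc) ps
...   | x , px = suc x , px

anyFin⁺ : ∀ {k} (p : Fin k → Bool) {x} → T (p x) → T (anyFin p)
anyFin⁺ p {zero} px = from T-∨ (inj₁ px)
anyFin⁺ p {suc x} px = from T-∨ (inj₂ (anyFin⁺ (p ∘ suc) px))

anyFin-cong : ∀ {k} {p q : Fin k → Bool} → p ≗ q → anyFin p ≡ anyFin q
anyFin-cong {zero} p≗q = refl
anyFin-cong {suc k} p≗q = cong₂ _∨_ (p≗q zero) (anyFin-cong (p≗q ∘ suc))

anyFin-false : ∀ k → anyFin {k} (λ _ → false) ≡ false
anyFin-false zero = refl
anyFin-false (suc k) = anyFin-false k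

allFin⁻ : ∀ {k} (p : Fin k → Bool) → T (allFin p) → ∀ x → T (p x)
allFin⁻ p h zero = proj₁ (to T-∧ h)
allFin⁻ p h (suc x) = allFin⁻ (p ∘ suc) (proj₂ (to T-∧ h)) x

allFin⁺ : ∀ {k} (p : Fin k → Bool) → (∀ x → T (p x)) → T (allFin p)
allFin⁺ {zero} p h = tt
allFin⁺ {suc k} p h = from T-∧ (h zero , allFin⁺ (p ∘ suc) (h ∘ suc))

∈⇒T-lookup : ∀ {n} {S : Subset n} {x} → x ∈ S → T (lookup S x)
∈⇒T-lookup x∈S = from T-≡ ([]=⇒lookup x∈S)

T-lookup⇒∈ : ∀ {n} {S : Subset n} {x} → T (lookup S x) → x ∈ S
T-lookup⇒∈ {S = S} {x} h = lookup⇒[]= x S (to T-≡ h)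

∈-tabulate⁻ : ∀ {n} {p : Fin n → Bool} {x} → x ∈ tabulate p → T (p x)
∈-tabulate⁻ {p = p} {x} x∈ = subst T (lookup∘tabulate p x) (∈⇒T-lookup x∈)

∈-tabulate⁺ : ∀ {n} {p : Fin n → Bool} {x} → T (p x) → x ∈ tabulate p
∈-tabulate⁺ {p = p} {x} px = T-lookup⇒∈ (subst T (≡.sym (lookup∘tabulate p x)) px)

range : ∀ {n k} → (Fin k → Fin n) → Subset n
range t = tabulate (λ y → anyFin (λ j → ⌊ t j Fin.≟ y ⌋))

∈-range⁻ : ∀ {n k} {t : Fin k → Fin n} {y} → y ∈ range t → ∃ λ j → t j ≡ y
∈-range⁻ y∈ = map₂ toWitness (anyFin⁻ _ (∈-tabulate⁻ y∈))

∈-range⁺ : ∀ {n k} {t : Fin k → Fin n} j → t j ∈ range t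
∈-range⁺ j = ∈-tabulate⁺ (anyFin⁺ _ {j} (fromWitness refl))

range-cong : ∀ {n k} {t u : Fin k → Fin n} → t ≗ u → range t ≡ range u
range-cong t≗u = tabulate-cong (λ y → anyFin-cong (λ j → cong (λ x → ⌊ x Fin.≟ y ⌋) (t≗u j)))

range-empty : ∀ {n} (t : Fin 0 → Fin n) → range t ≡ ⊥
range-empty t = ⊆-antisym (λ y∈ → ⊥-elim (¬Fin0 (proj₁ (∈-range⁻ {t = t} y∈)))) ⊥⊆

range-cons-zero : ∀ {n k} (t : Fin k → Fin n) → range (zero Vector.∷ suc ∘ t) ≡ true ∷ range t
range-cons-zero t = cong (true ∷_) (tabulate-cong (λ y → anyFin-cong (λ j → ⌊⌋-map′ _ _ (t j Fin.≟ y))))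

range-suc : ∀ {n k} (t : Fin k → Fin n) → range (suc ∘ t) ≡ false ∷ range t
range-suc {k = k} t =
  cong₂ _∷_ (anyFin-false k) (tabulate-cong (λ y → anyFin-cong (λ j → ⌊⌋-map′ _ _ (t j Fin.≟ y))))

Increasing : ∀ {k n} → (Fin k → Fin n) → Set
Increasing t = ∀ {i j} → i Fin.< j → t i Fin.< t j

Bounded : ∀ {k n} → ℕ → (Fin k → Fin n) → Set
Bounded m t = ∀ j → toℕ (t j) ≤ m + toℕ j

module _ {k n} {t : Fin k → Fin n} (t↑ : Increasing t) where

  increasing-reflects-≤ : ∀ {i j} → t i Fin.≤ t j → i Fin.≤ j
  increasing-reflects-≤ ti≤tj = ≮⇒≥ (λ j<i → <⇒≱ (t↑ j<i) ti≤tj)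

  increasing-monotone : ∀ {i j} → i Fin.≤ j → t i Fin.≤ t j
  increasing-monotone i≤j with m≤n⇒m<n∨m≡n i≤j
  ... | inj₁ i<j = <⇒≤ (t↑ i<j)
  ... | inj₂ i≡j = ≤ᶠ-reflexive (cong t (toℕ-injective i≡j))

  increasing-injective : ∀ {i j} → t i ≡ t j → i ≡ j
  increasing-injective ti≡tj =
    ≤ᶠ-antisym (increasing-reflects-≤ (≤ᶠ-reflexive ti≡tj))
               (increasing-reflects-≤ (≤ᶠ-reflexive (≡.sym ti≡tj)))

increasing-resp : ∀ {k n} {t u : Fin k → Fin n} → t ≗ u → Increasing t → Increasing u
increasing-resp t≗u t↑ {i} {j} i<j = subst₂ Fin._<_ (t≗u i) (t≗u j) (t↑ i<j)

bounded-resp : ∀ {k n m} {t u : Fin k → Fin n} → t ≗ u → Bounded m t → Bounded m u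
bounded-resp {m = m} t≗u t≤ j = subst (λ x → toℕ x ≤ m + toℕ j) (t≗u j) (t≤ j)

increasing-cons-zero : ∀ {k n} (t : Fin k → Fin n) → Increasing (zero Vector.∷ Fin.suc ∘ t) ⇔ Increasing t
increasing-cons-zero t = mk⇔ cons↑⁻ cons↑⁺
  where
  cons↑⁻ : Increasing (zero Vector.∷ Fin.suc ∘ t) → Increasing t
  cons↑⁻ t↑ i<j = s<s⁻¹ (t↑ (s<s i<j))
  cons↑⁺ : Increasing t → Increasing (zero Vector.∷ Fin.suc ∘ t)
  cons↑⁺ t↑ {zero} {suc j} _ = z<s
  cons↑⁺ t↑ {suc i} {suc j} i<j = s<s (t↑ (s<s⁻¹ i<j))

increasing-suc : ∀ {k n} (t : Fin k → Fin n) → Increasing (Fin.suc ∘ t) ⇔ Increasing t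
increasing-suc t = mk⇔ suc↑⁻ suc↑⁺
  where
  suc↑⁻ : Increasing (Fin.suc ∘ t) → Increasing t
  suc↑⁻ t↑ i<j = s<s⁻¹ (t↑ i<j)
  suc↑⁺ : Increasing t → Increasing (Fin.suc ∘ t)
  suc↑⁺ t↑ i<j = s<s (t↑ i<j)

bounded-cons-zero : ∀ {k n} m (t : Fin k → Fin n) → Bounded m (zero Vector.∷ Fin.suc ∘ t) ⇔ Bounded m t
bounded-cons-zero m t = mk⇔
  (λ t≤ j → s≤s⁻¹ (subst (suc (toℕ (t j)) ≤_) (+-suc m (toℕ j)) (t≤ (suc j))))
  (λ { t≤ zero → z≤n
      ; t≤ (suc j) → subst (suc (toℕ (t j)) ≤_) (≡.sym (+-suc m (toℕ j))) (s≤s (t≤ j)) })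

bounded-suc : ∀ {k n} m (t : Fin k → Fin n) → Bounded (suc m) (Fin.suc ∘ t) ⇔ Bounded m t
bounded-suc m t = mk⇔ (λ t≤ → s≤s⁻¹ ∘ t≤) (λ t≤ → s≤s ∘ t≤)

factor-suc : ∀ {k n} (t : Fin k → Fin (suc n)) → (∀ j → t j ≢ zero) → ∃ λ t′ → t ≗ Fin.suc ∘ t′
factor-suc t t≢0 =
  (λ j → Fin.punchOut (t≢0 j ∘ ≡.sym)) , (λ j → ≡.sym (punchIn-punchOut (t≢0 j ∘ ≡.sym)))

increasing-tail≢0 : ∀ {k n} {t : Fin (suc k) → Fin (suc n)} → Increasing t → ∀ j → t (suc j) ≢ zero
increasing-tail≢0 {t = t} t↑ j tj≡0 = n≮0 (subst (λ x → toℕ (t zero) < toℕ x) tj≡0 (t↑ z<s))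

increasing-shape : ∀ {k n} (t : Fin (suc k) → Fin (suc n)) → Increasing t →
                   (∃ λ t′ → t ≗ zero Vector.∷ Fin.suc ∘ t′) ⊎ (∃ λ t′ → t ≗ Fin.suc ∘ t′)
increasing-shape t t↑ with t zero in t₀≡
... | zero with factor-suc (t ∘ suc) (increasing-tail≢0 t↑)
...   | t′ , t∘suc≗ = inj₁ (t′ , λ { zero → t₀≡ ; (suc j) → t∘suc≗ j })
increasing-shape t t↑ | suc _ = inj₂ (factor-suc t t≢0)
  where
  t≢0 : ∀ j → t j ≢ zero
  t≢0 zero t₀≡0 = 0≢1+n (≡.trans (≡.sym t₀≡0) t₀≡)
  t≢0 (suc j) = increasing-tail≢0 t↑ j

BoundedRange : ∀ {n} → ℕ → ℕ → Subset n → Set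
BoundedRange {n} m k T = ∃ λ (t : Fin k → Fin n) → Increasing t × Bounded m t × range t ≡ T

boundedRange-true∷ : ∀ {n m k} {T : Subset n} → BoundedRange m k T → BoundedRange m (suc k) (true ∷ T)
boundedRange-true∷ {m = m} (t , t↑ , t≤ , t⇒T) =
  zero Vector.∷ Fin.suc ∘ t , from (increasing-cons-zero t) t↑ , from (bounded-cons-zero m t) t≤ ,
  ≡.trans (range-cons-zero t) (cong (true ∷_) t⇒T)

boundedRange-false∷ : ∀ {n m k} {T : Subset n} → BoundedRange m k T → BoundedRange (suc m) k (false ∷ T)
boundedRange-false∷ {m = m} (t , t↑ , t≤ , t⇒T) =
  Fin.suc ∘ t , from (increasing-suc t) t↑ , from (bounded-suc m t) t≤ ,
  ≡.trans (range-suc t) (cong (false ∷_) t⇒T)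

mutual
  boundedSubset : ∀ n m k → Fin (binom m k) → Subset n
  boundedSubset n m zero _ = ⊥
  boundedSubset zero m (suc k) _ = []
  boundedSubset (suc n) zero (suc k) i = true ∷ boundedSubset n zero k i
  boundedSubset (suc n) (suc m) (suc k) i = prepend n m k (splitAt (binom (suc m) k) i)

  prepend : ∀ n m k → Fin (binom (suc m) k) ⊎ Fin (binom m (suc k)) → Subset (suc n)
  prepend n m k (inj₁ i) = true ∷ boundedSubset n (suc m) k i
  prepend n m k (inj₂ i) = false ∷ boundedSubset n m (suc k) i

boundedSubset-true∷ : ∀ n m k i →
                      ∃ λ i′ → boundedSubset (suc n) m (suc k) i′ ≡ true ∷ boundedSubset n m k i
boundedSubset-true∷ n zero k i = i , refl
boundedSubset-true∷ n (suc m) k i =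
  i ↑ˡ binom m (suc k) , cong (prepend n m k) (splitAt-↑ˡ (binom (suc m) k) i (binom m (suc k)))

boundedSubset-false∷ : ∀ n m k i →
                       ∃ λ i′ → boundedSubset (suc n) (suc m) (suc k) i′ ≡ false ∷ boundedSubset n m (suc k) i
boundedSubset-false∷ n m k i =
  binom (suc m) k ↑ʳ i , cong (prepend n m k) (splitAt-↑ʳ (binom (suc m) k) (binom m (suc k)) i)

splitAt-injective : ∀ m {n} → Injective _≡_ _≡_ (splitAt m {n})
splitAt-injective m {n} {i} {i′} eq = begin
  i                      ≡⟨ join-splitAt m n i ⟨
  join m n (splitAt m i)  ≡⟨ cong (join m n) eq ⟩
  join m n (splitAt m i′) ≡⟨ join-splitAt m n i′ ⟩
  i′                     ∎
  where open ≡-Reasoning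

boundedSubset-injective : ∀ n m k → m + k ≤ n → Injective _≡_ _≡_ (boundedSubset n m k)
boundedSubset-injective n m zero _ {zero} {zero} _ = refl
boundedSubset-injective zero m (suc k) m+k≤0 = contradiction (m+n≤o⇒n≤o m m+k≤0) λ ()
boundedSubset-injective (suc n) zero (suc k) (s≤s k≤n) eq = boundedSubset-injective n zero k k≤n (∷-injectiveʳ eq)
boundedSubset-injective (suc n) (suc m) (suc k) (s≤s m+[1+k]≤n) eq =
  splitAt-injective (binom (suc m) k) (prepend-injective _ _ eq)
  where
  prepend-injective : ∀ s s′ → prepend n m k s ≡ prepend n m k s′ → s ≡ s′
  prepend-injective (inj₁ i) (inj₁ i′) eq =
    cong inj₁ (boundedSubset-injective n (suc m) k (subst (_≤ n) (+-suc m k) m+[1+k]≤n) (∷-injectiveʳ eq))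
  prepend-injective (inj₁ i) (inj₂ i′) eq with ∷-injectiveˡ eq
  ... | ()
  prepend-injective (inj₂ i) (inj₁ i′) eq with ∷-injectiveˡ eq
  ... | ()
  prepend-injective (inj₂ i) (inj₂ i′) eq =
    cong inj₂ (boundedSubset-injective n m (suc k) m+[1+k]≤n (∷-injectiveʳ eq))

boundedSubset-boundedRange : ∀ n m k → m + k ≤ n → ∀ i → BoundedRange m k (boundedSubset n m k i)
boundedSubset-boundedRange n m zero _ _ = (λ ()) , (λ {i} _ → ⊥-elim (¬Fin0 i)) , (λ ()) , range-empty (λ ())
boundedSubset-boundedRange zero m (suc k) m+k≤0 _ = contradiction (m+n≤o⇒n≤o m m+k≤0) λ ()
boundedSubset-boundedRange (suc n) zero (suc k) (s≤s k≤n) i =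
  boundedRange-true∷ (boundedSubset-boundedRange n zero k k≤n i)
boundedSubset-boundedRange (suc n) (suc m) (suc k) (s≤s m+[1+k]≤n) i = prepend-boundedRange (splitAt _ i)
  where
  prepend-boundedRange : ∀ s → BoundedRange (suc m) (suc k) (prepend n m k s)
  prepend-boundedRange (inj₁ i) =
    boundedRange-true∷ (boundedSubset-boundedRange n (suc m) k (subst (_≤ n) (+-suc m k) m+[1+k]≤n) i)
  prepend-boundedRange (inj₂ i) = boundedRange-false∷ (boundedSubset-boundedRange n m (suc k) m+[1+k]≤n i)

boundedSubset-surjective : ∀ n m k {T : Subset n} → BoundedRange m k T → ∃ λ i → boundedSubset n m k i ≡ T
boundedSubset-surjective n m zero (t , _ , _ , refl) = zero , ≡.sym (range-empty t)
boundedSubset-surjective zero m (suc k) (t , _) = ⊥-elim (¬Fin0 (t zero))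
boundedSubset-surjective (suc n) m (suc k) (t , t↑ , t≤ , refl) with increasing-shape t t↑
... | inj₁ (t′ , t≗) with boundedSubset-surjective n m k
                          (t′ , to (increasing-cons-zero t′) (increasing-resp t≗ t↑) ,
                                to (bounded-cons-zero m t′) (bounded-resp t≗ t≤) , refl)
...   | i , i⇒t′ with boundedSubset-true∷ n m k i
...     | i′ , i′⇒ = i′ , (begin
  boundedSubset (suc n) m (suc k) i′ ≡⟨ i′⇒ ⟩
  true ∷ boundedSubset n m k i       ≡⟨ cong (true ∷_) i⇒t′ ⟩
  true ∷ range t′                    ≡⟨ range-cons-zero t′ ⟨
  range (zero Vector.∷ Fin.suc ∘ t′) ≡⟨ range-cong t≗ ⟨
  range t                            ∎)
  where open ≡-Reasoning
boundedSubset-surjective (suc n) zero (suc k) (t , t↑ , t≤ , refl) | inj₂ (t′ , t≗)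
  with subst (λ x → toℕ x ≤ 0) (t≗ zero) (t≤ zero)
... | ()
boundedSubset-surjective (suc n) (suc m) (suc k) (t , t↑ , t≤ , refl) | inj₂ (t′ , t≗)
  with boundedSubset-surjective n m (suc k)
         (t′ , to (increasing-suc t′) (increasing-resp t≗ t↑) ,
               to (bounded-suc m t′) (bounded-resp t≗ t≤) , refl)
... | i , i⇒t′ with boundedSubset-false∷ n m k i
...   | i′ , i′⇒ = i′ , (begin
  boundedSubset (suc n) (suc m) (suc k) i′ ≡⟨ i′⇒ ⟩
  false ∷ boundedSubset n m (suc k) i      ≡⟨ cong (false ∷_) i⇒t′ ⟩
  false ∷ range t′                         ≡⟨ range-suc t′ ⟨
  range (Fin.suc ∘ t′)                     ≡⟨ range-cong t≗ ⟨
  range t                                  ∎)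
  where open ≡-Reasoning

isJust⁻ : ∀ {n} (mx : Maybe (Fin n)) → T (isJust mx) → ∃ λ a → mx ≡ just a
isJust⁻ (just a) _ = a , refl

hits⁻ : ∀ {n} (mx : Maybe (Fin n)) {y} → T (hits mx y) → mx ≡ just y
hits⁻ (just a) a≡y = cong just (toWitness a≡y)

module _ {n} (f : IC n) {S : Subset n} where

  ∈-image⁻ : ∀ {y} → y ∈ image f S → ∃ λ x → x ∈ S × IC.fun f x ≡ just y
  ∈-image⁻ y∈ with anyFin⁻ _ (∈-tabulate⁻ y∈)
  ... | x , h with to T-∧ h
  ...   | x∈S , hit = x , T-lookup⇒∈ x∈S , hits⁻ (IC.fun f x) hit

  ∈-image⁺ : ∀ {x y} → x ∈ S → IC.fun f x ≡ just y → y ∈ image f S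
  ∈-image⁺ {x} {y} x∈S fx≡y =
    ∈-tabulate⁺ (anyFin⁺ _ {x} (from T-∧ (∈⇒T-lookup x∈S , hit)))
    where
    hit : T (hits (IC.fun f x) y)
    hit = subst (λ mx → T (hits mx y)) (≡.sym fx≡y) (fromWitness refl)

  ⊆dom⁻ : T (⊆dom f S) → ∀ {x} → x ∈ S → T (isJust (IC.fun f x))
  ⊆dom⁻ S⊆ {x} x∈S =
    subst (λ b → T (if b then isJust (IC.fun f x) else true)) ([]=⇒lookup x∈S) (allFin⁻ _ S⊆ x)

  ⊆dom⁺ : (∀ {x} → x ∈ S → T (isJust (IC.fun f x))) → T (⊆dom f S)
  ⊆dom⁺ S⊆ = allFin⁺ _ at
    where
    at : ∀ x → T (if lookup S x then isJust (IC.fun f x) else true)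
    at x with lookup S x in Sx
    ... | true = S⊆ (lookup⇒[]= x S Sx)
    ... | false = tt

module _ {n k} (f : IC n) {s t : Fin k → Fin n} (f∘s≡t : ∀ j → IC.fun f (s j) ≡ just (t j)) where

  restriction-increasing : Increasing s → Increasing t
  restriction-increasing s↑ {i} {j} i<j = ≤∧≢⇒< ti≤tj ti≢tj
    where
    ti≤tj : t i Fin.≤ t j
    ti≤tj = IC.order-preserving f (s i) (s j) (t i) (t j) (f∘s≡t i) (f∘s≡t j) (<⇒≤ (s↑ i<j))
    ti≢tj : t i ≢ t j
    ti≢tj ti≡tj =
      <⇒≢ (s↑ i<j) (IC.injective f (s i) (s j) (t j) (≡.trans (f∘s≡t i) (cong just ti≡tj)) (f∘s≡t j))

  restriction-below : ∀ j → t j Fin.≤ s j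
  restriction-below j = IC.order-decreasing f (s j) (t j) (f∘s≡t j)

  range⊆dom : T (⊆dom f (range s))
  range⊆dom = ⊆dom⁺ f at
    where
    at : ∀ {x} → x ∈ range s → T (isJust (IC.fun f x))
    at x∈ with ∈-range⁻ {t = s} x∈
    ... | j , refl = subst (T ∘ isJust) (≡.sym (f∘s≡t j)) tt

  image-range : image f (range s) ≡ range t
  image-range = ⊆-antisym image⊆ ⊆image
    where
    image⊆ : ∀ {y} → y ∈ image f (range s) → y ∈ range t
    image⊆ y∈ with ∈-image⁻ f y∈
    ... | x , x∈ , fx≡y with ∈-range⁻ {t = s} x∈
    ...   | j , refl = subst (_∈ range t) (just-injective (≡.trans (≡.sym (f∘s≡t j)) fx≡y)) (∈-range⁺ j)
    ⊆image : ∀ {y} → y ∈ range t → y ∈ image f (range s)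
    ⊆image y∈ with ∈-range⁻ {t = t} y∈
    ... | j , refl = ∈-image⁺ f (∈-range⁺ j) (f∘s≡t j)

module _ {n k} {s t : Fin k → Fin n} (s↑ : Increasing s) (t↑ : Increasing t) (t≤s : ∀ j → t j Fin.≤ s j) where

  private
    Preimage : Fin n → Set
    Preimage x = ∃ λ j → s j ≡ x

    valueAt : ∀ {x} → Dec (Preimage x) → Maybe (Fin n)
    valueAt (yes (j , _)) = just (t j)
    valueAt (no _) = nothing

    valueAt⁻ : ∀ {x a} (d : Dec (Preimage x)) → valueAt d ≡ just a → ∃ λ j → s j ≡ x × t j ≡ a
    valueAt⁻ (yes (j , sj≡x)) tj≡a = j , sj≡x , just-injective tj≡a

    valueAt-s : ∀ j (d : Dec (Preimage (s j))) → valueAt d ≡ just (t j)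
    valueAt-s j (yes (i , si≡sj)) = cong (just ∘ t) (increasing-injective s↑ si≡sj)
    valueAt-s j (no ∄) = contradiction (j , refl) ∄

    graph-fun : Fin n → Maybe (Fin n)
    graph-fun x = valueAt (any? (λ j → s j Fin.≟ x))

  graph : IC n
  graph = record
    { fun = graph-fun
    ; injective = λ x y a fx≡a fy≡a → injective (valueAt⁻ _ fx≡a) (valueAt⁻ _ fy≡a)
    ; order-preserving = λ x y a b fx≡a fy≡b →
        order-preserving (valueAt⁻ _ fx≡a) (valueAt⁻ _ fy≡b)
    ; order-decreasing = λ x a fx≡a → order-decreasing (valueAt⁻ _ fx≡a)
    }
    where
    injective : ∀ {x y a} → (∃ λ i → s i ≡ x × t i ≡ a) → (∃ λ j → s j ≡ y × t j ≡ a) → x ≡ y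
    injective (i , refl , refl) (j , refl , ti≡tj) = cong s (increasing-injective t↑ (≡.sym ti≡tj))
    order-preserving : ∀ {x y a b} → (∃ λ i → s i ≡ x × t i ≡ a) → (∃ λ j → s j ≡ y × t j ≡ b) →
                       x Fin.≤ y → a Fin.≤ b
    order-preserving (i , refl , refl) (j , refl , refl) si≤sj =
      increasing-monotone t↑ (increasing-reflects-≤ s↑ si≤sj)
    order-decreasing : ∀ {x a} → (∃ λ j → s j ≡ x × t j ≡ a) → a Fin.≤ x
    order-decreasing (j , refl , refl) = t≤s j

  graph-at : ∀ j → IC.fun graph (s j) ≡ just (t j)
  graph-at j = valueAt-s j _

module _ {n k} {s : Fin k → Fin n} (s↑ : Increasing s) where

  range-orbit⁻ : ∀ f → T (⊆dom f (range s)) →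
                 ∃ λ t → Increasing t × (∀ j → t j Fin.≤ s j) × image f (range s) ≡ range t
  range-orbit⁻ f S⊆ =
    t , restriction-increasing f f∘s≡t s↑ , restriction-below f f∘s≡t , image-range f f∘s≡t
    where
    defined : ∀ j → ∃ λ a → IC.fun f (s j) ≡ just a
    defined j = isJust⁻ (IC.fun f (s j)) (⊆dom⁻ f S⊆ (∈-range⁺ j))
    t : Fin k → Fin n
    t = proj₁ ∘ defined
    f∘s≡t : ∀ j → IC.fun f (s j) ≡ just (t j)
    f∘s≡t = proj₂ ∘ defined

  range-orbit⁺ : ∀ {t : Fin k → Fin n} → Increasing t → (∀ j → t j Fin.≤ s j) →
                 ∃ λ f → T (⊆dom f (range s)) × image f (range s) ≡ range t
  range-orbit⁺ {t} t↑ t≤s = f , range⊆dom f at , image-range f at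
    where
    f : IC n
    f = graph s↑ t↑ t≤s
    at : ∀ j → IC.fun f (s j) ≡ just (t j)
    at = graph-at s↑ t↑ t≤s

interval-membership : ∀ {n} m k {x : Fin n} → x ∈ interval n m k ⇔ (m ≤ toℕ x × toℕ x < m + k)
interval-membership m k {x} = mk⇔
  (λ x∈ → let m≤x , x<m+k = to T-∧′ (∈-tabulate⁻ x∈) in toWitness m≤x , toWitness x<m+k)
  (λ (m≤x , x<m+k) → ∈-tabulate⁺ (from T-∧′ (fromWitness m≤x , fromWitness x<m+k)))
  where
  T-∧′ : T (⌊ m ≤? toℕ x ⌋ ∧ ⌊ toℕ x <? m + k ⌋) ⇔ (T ⌊ m ≤? toℕ x ⌋ × T ⌊ toℕ x <? m + k ⌋)
  T-∧′ = T-∧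

module Slots {n m k} (m+k≤n : m + k ≤ n) where

  slot : Fin k → Fin n
  slot j = fromℕ< (≤-trans (+-monoʳ-< m (toℕ<n j)) m+k≤n)

  toℕ-slot : ∀ j → toℕ (slot j) ≡ m + toℕ j
  toℕ-slot j = toℕ-fromℕ< _

  slot-increasing : Increasing slot
  slot-increasing {i} {j} i<j = subst₂ _<_ (≡.sym (toℕ-slot i)) (≡.sym (toℕ-slot j)) (+-monoʳ-< m i<j)

  interval≡range-slot : interval n m k ≡ range slot
  interval≡range-slot = ⊆-antisym interval⊆ ⊆interval
    where
    interval⊆ : ∀ {x} → x ∈ interval n m k → x ∈ range slot
    interval⊆ {x} x∈ with to (interval-membership m k) x∈
    ... | m≤x , x<m+k = subst (_∈ range slot) slot-j≡x (∈-range⁺ j)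
      where
      j<k : toℕ x ∸ m < k
      j<k = +-cancelˡ-< m _ _ (subst (_< m + k) (≡.sym (m+[n∸m]≡n m≤x)) x<m+k)
      j : Fin k
      j = fromℕ< j<k
      slot-j≡x : slot j ≡ x
      slot-j≡x = toℕ-injective (begin
        toℕ (slot j)     ≡⟨ toℕ-slot j ⟩
        m + toℕ j        ≡⟨ cong (m +_) (toℕ-fromℕ< j<k) ⟩
        m + (toℕ x ∸ m)  ≡⟨ m+[n∸m]≡n m≤x ⟩
        toℕ x            ∎)
        where open ≡-Reasoning
    ⊆interval : ∀ {x} → x ∈ range slot → x ∈ interval n m k
    ⊆interval x∈ with ∈-range⁻ {t = slot} x∈
    ... | j , refl = from (interval-membership m k)
      (subst (m ≤_) (≡.sym (toℕ-slot j)) (m≤m+n m (toℕ j)) ,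
       subst (_< m + k) (≡.sym (toℕ-slot j)) (+-monoʳ-< m (toℕ<n j)))

  below-slot⇔bounded : ∀ {t : Fin k → Fin n} → (∀ j → t j Fin.≤ slot j) ⇔ Bounded m t
  below-slot⇔bounded {t} = mk⇔
    (λ t≤ j → subst (toℕ (t j) ≤_) (toℕ-slot j) (t≤ j))
    (λ t≤ j → subst (toℕ (t j) ≤_) (≡.sym (toℕ-slot j)) (t≤ j))

  slot-orbit⁻ : ∀ f → T (⊆dom f (range slot)) → ∃ λ i → image f (range slot) ≡ boundedSubset n m k i
  slot-orbit⁻ f S⊆ with range-orbit⁻ slot-increasing f S⊆
  ... | t , t↑ , t≤ , f[S]≡t with boundedSubset-surjective n m k (t , t↑ , to below-slot⇔bounded t≤ , refl)
  ...   | i , i⇒t = i , ≡.trans f[S]≡t (≡.sym i⇒t)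

  slot-orbit⁺ : ∀ i → ∃ λ f → T (⊆dom f (range slot)) × image f (range slot) ≡ boundedSubset n m k i
  slot-orbit⁺ i with boundedSubset-boundedRange n m k m+k≤n i
  ... | t , t↑ , t≤ , t⇒i with range-orbit⁺ slot-increasing t↑ (from below-slot⇔bounded t≤)
  ...   | f , S⊆ , f[S]≡t = f , S⊆ , ≡.trans f[S]≡t t⇒i

module _ {c ℓ} (F : Field c ℓ) where
  open Field F renaming (_+_ to _+ᶠ_; refl to ≈-refl)
  open Module F
  open import Algebra.Properties.Semiring.Sum semiring using (sum; sum-cong-≋; sum-replicate-zero; sum-remove)
  open import Relation.Binary.Reasoning.Setoid setoid

  Σ≡sum : ∀ {d} (a : Fin d → Carrier) → Σ[ a ] ≡ sum a
  Σ≡sum {zero} a = ≡.refl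
  Σ≡sum {suc d} a = cong (a zero +ᶠ_) (Σ≡sum (a ∘ suc))

  Σ-zero : ∀ {d} (a : Fin d → Carrier) → (∀ i → a i ≈ 0#) → Σ[ a ] ≈ 0#
  Σ-zero {d} a a≈0 = begin
    Σ[ a ]                      ≡⟨ Σ≡sum a ⟩
    sum a                       ≈⟨ sum-cong-≋ a≈0 ⟩
    sum (Vector.replicate d 0#) ≈⟨ sum-replicate-zero d ⟩
    0#                          ∎

  Σ-δ : ∀ {d} (a : Fin d → Carrier) i → (∀ j → j ≢ i → a j ≈ 0#) → Σ[ a ] ≈ a i
  Σ-δ {suc d} a i a≈0 = begin
    Σ[ a ]                          ≡⟨ Σ≡sum a ⟩
    sum a                           ≈⟨ sum-remove {i = i} a ⟩
    a i +ᶠ sum (a ∘ Fin.punchIn i)   ≡⟨ cong (a i +ᶠ_) (Σ≡sum (a ∘ Fin.punchIn i)) ⟨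
    a i +ᶠ Σ[ a ∘ Fin.punchIn i ]    ≈⟨ +-congˡ (Σ-zero _ (λ j → a≈0 (Fin.punchIn i j) (punchInᵢ≢i i j))) ⟩
    a i +ᶠ 0#                        ≈⟨ +-identityʳ (a i) ⟩
    a i                             ∎

  v-self : ∀ {n} (U : Subset n) → v U U ≈ 1#
  v-self U with ≡-dec Bool._≟_ U U
  ... | yes _ = ≈-refl
  ... | no U≢U = contradiction ≡.refl U≢U

  v-other : ∀ {n} {U W : Subset n} → U ≢ W → v U W ≈ 0#
  v-other {U = U} {W} U≢W with ≡-dec Bool._≟_ U W
  ... | yes U≡W = contradiction U≡W U≢W
  ... | no _ = ≈-refl

  lincomb-vanishes : ∀ {n d} cs (bs : Fin d → V n) {U} → (∀ i → bs i U ≈ 0#) → lincomb cs bs U ≈ 0#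
  lincomb-vanishes cs bs bs≈0 = Σ-zero _ (λ i → trans (*-congˡ (bs≈0 i)) (zeroʳ (cs i)))

  lincomb-basis : ∀ {n d} {e : Fin d → Subset n} → Injective _≡_ _≡_ e → ∀ cs i → lincomb cs (v ∘ e) (e i) ≈ cs i
  lincomb-basis {e = e} e-inj cs i = begin
    lincomb cs (v ∘ e) (e i) ≈⟨ Σ-δ _ i (λ j j≢i → trans (*-congˡ (v-other (j≢i ∘ e-inj))) (zeroʳ (cs j))) ⟩
    cs i * v (e i) (e i)     ≈⟨ *-congˡ (v-self (e i)) ⟩
    cs i * 1#                ≈⟨ *-identityʳ (cs i) ⟩
    cs i                     ∎

  hasDim-⟨v⟩ : ∀ {n d} (S : Subset n) (e : Fin d → Subset n) → Injective _≡_ _≡_ e →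
               (∀ i → ∃ λ f → T (⊆dom f S) × image f S ≡ e i) →
               (∀ f → T (⊆dom f S) → ∃ λ i → image f S ≡ e i) →
               HasDim (⟨v_⟩ S) d
  hasDim-⟨v⟩ {n} {d} S e e-inj e-in-orbit orbit-in-e = v ∘ e , v∘e-in-span , independent , spanning
    where
    act-defined : ∀ f → T (⊆dom f S) → act f S ≡ v (image f S)
    act-defined f S⊆ with ⊆dom f S | S⊆
    ... | true | _ = ≡.refl

    act-off-basis : ∀ {U} → (∀ i → e i ≢ U) → ∀ f → act f S U ≈ 0#
    act-off-basis {U} U≢e f with ⊆dom f S in S⊆
    ... | false = ≈-refl
    ... | true with orbit-in-e f (from T-≡ S⊆)
    ...   | i , f[S]≡ei = subst (λ W → v W U ≈ 0#) (≡.sym f[S]≡ei) (v-other (U≢e i))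

    v∘e-in-span : ∀ i → ⟨v_⟩ S (v (e i))
    v∘e-in-span i with e-in-orbit i
    ... | f , S⊆ , f[S]≡ei = 1 , (λ _ → 1#) , (λ _ → f) , λ U →
      subst (λ w → v (e i) U ≈ 1# * w U +ᶠ 0#) (≡.sym (≡.trans (act-defined f S⊆) (cong v f[S]≡ei)))
            (sym (trans (+-identityʳ _) (*-identityˡ _)))

    independent : LinIndep (v ∘ e)
    independent cs comb≈0 i = trans (sym (lincomb-basis e-inj cs i)) (comb≈0 (e i))

    spanning : ∀ w → ⟨v_⟩ S w → Σ (Fin d → Carrier) λ cs → w ≈V lincomb cs (v ∘ e)
    spanning w (_ , cs , fs , w≈) = w ∘ e , at
      where
      at : ∀ U → w U ≈ lincomb (w ∘ e) (v ∘ e) U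
      at U with any? (λ i → ≡-dec Bool._≟_ (e i) U)
      ... | yes (i , ≡.refl) = sym (lincomb-basis e-inj (w ∘ e) i)
      ... | no U∉e = begin
        w U                               ≈⟨ w≈ U ⟩
        lincomb cs (λ j → act (fs j) S) U ≈⟨ lincomb-vanishes cs (λ j → act (fs j) S) (act-off-basis U≢e ∘ fs) ⟩
        0#                                ≈⟨ lincomb-vanishes (w ∘ e) (v ∘ e) (v-other ∘ U≢e) ⟨
        lincomb (w ∘ e) (v ∘ e) U         ∎
        where
        U≢e : ∀ i → e i ≢ U
        U≢e i = U∉e ∘ (i ,_)

corollary4p8 : ∀ {c ℓ : Level} (F : Field c ℓ) → CharZero F →
               (n m k : ℕ) → m + k ≤ n →
               Module.HasDim F (Module.⟨v_⟩ F (interval n m k)) ((m + k) C k)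
corollary4p8 F _ n m k m+k≤n =
  subst₂ (λ S d → Module.HasDim F (Module.⟨v_⟩ F S) d) (≡.sym interval≡range-slot) (binom≡C m k)
    (hasDim-⟨v⟩ F (range slot) (boundedSubset n m k) (boundedSubset-injective n m k m+k≤n)
                slot-orbit⁺ slot-orbit⁻)
  where open Slots {n} {m} {k} m+k≤n
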